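{- Work in $\mathbf{MLTT_0}$ (intensional Martin-Löf type theory with $\mathsf{N_0}$, $\mathsf{N_1}$, $\Sigma$, $\Pi$, $\mathsf{List}$, $\mathsf{Id}$, $+$, a universe $\mathsf{U_0}$ à la Russell, and $\eta$-equalities for $\mathsf{N_1}$, $\Sigma$ and $\Pi$). Let $A \in \mathsf{U_0}$ and $I(x) \in \mathsf{U_0}$ $[x \in A]$. For a rule set given by $C(x,y) \in A \to \mathsf{U_0}$ $[x \in A, y \in I(x)]$, define the (dependent copolynomial) endofunctor on the category of $A$-dependent types $\mathsf{Conf}_{I,C}(P)(x) :\equiv (\Pi y \in I(x))(\Sigma z \in A)(C(x,y,z) \times P(z))$. For an indexed container given by $Br(x,y) \in \mathsf{U_0}$ and $ar(x,y) \in Br(x,y) \to A$ $[x \in A, y \in I(x)]$, define $\mathsf{Conf}_{Br,ar}(P)(x) :\equiv (\Pi y \in I(x))(\Sigma z \in Br(x,y))P(ar(x,y,z))$. Then each functor of the form $\mathsf{Conf}_{I,C}$ is isomorphic to one of the form $\mathsf{Conf}_{Br,ar}$; assuming function extensionality ($\mathsf{funext}$), also the converse holds (each $\mathsf{Conf}_{Br,ar}$ is isomorphic to some $\mathsf{Conf}_{I,C}$).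
   Context: Dependent copolynomial endofunctors used to describe (proof-relevant) coinductive predicates in Martin-Löf's type theory. -}

module Defs where

open import Data.Product using (Σ; _×_; _,_; proj₁; proj₂)
open import Relation.Binary.PropositionalEquality using (_≡_)

Hom : {A : Set} → (A → Set) → (A → Set) → Set
Hom {A} P Q = (x : A) → P x → Q x

record Endo (A : Set) : Set₁ where
  field
    obj : (A → Set) → (A → Set)
    hom : {P Q : A → Set} → Hom P Q → Hom (obj P) (obj Q)

-- Natural isomorphism between endofunctors; equality of morphisms is
-- taken pointwise (identity type Id on elements).
record NatIso {A : Set} (F G : Endo A) : Set₁ where
  private
    module F = Endo F
    module G = Endo G
  field
    to       : (P : A → Set) → Hom (F.obj P) (G.obj P)
    from     : (P : A → Set) → Hom (G.obj P) (F.obj P)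
    from∘to  : (P : A → Set) (x : A) (u : F.obj P x) → from P x (to P x u) ≡ u
    to∘from  : (P : A → Set) (x : A) (v : G.obj P x) → to P x (from P x v) ≡ v
    natural  : (P Q : A → Set) (f : Hom P Q) (x : A) (u : F.obj P x)
               → to Q x (F.hom f x u) ≡ G.hom f x (to P x u)

ConfIC : {A : Set} (I : A → Set) (C : (x : A) → I x → A → Set) → Endo A
Endo.obj (ConfIC {A} I C) P x = (y : I x) → Σ A (λ z → C x y z × P z)
Endo.hom (ConfIC I C) f x g y =
  proj₁ (g y) , proj₁ (proj₂ (g y)) , f (proj₁ (g y)) (proj₂ (proj₂ (g y)))

ConfBr : {A : Set} (I : A → Set) (Br : (x : A) → I x → Set)
         (ar : (x : A) (y : I x) → Br x y → A) → Endo A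
Endo.obj (ConfBr I Br ar) P x = (y : I x) → Σ (Br x y) (λ z → P (ar x y z))
Endo.hom (ConfBr I Br ar) f x g y =
  proj₁ (g y) , f (ar x y (proj₁ (g y))) (proj₂ (g y))

{-# OPTIONS --safe #-}
-- A rule set C becomes a container by taking as branches the pairs (z , c) of a
-- premise z with a rule c ∈ C(x,y,z), and z as arity; both round trips hold
-- definitionally by η for Σ and Π. Conversely a container (Br , ar) becomes the
-- rule set with C(x,y,z) the fibre of ar(x,y) over z. Going back and forth
-- through a fibre returns an element only up to path induction on its equality
-- proof, so this round trip holds pointwise, and funext is needed to assemble it
-- under the Π over I(x).
module Submission where

open import Defs
open import Data.Product using (Σ; _×_; _,_; proj₁; assocʳ; assocˡ)
open import Level using (0ℓ)
open import Axiom.Extensionality.Propositional using (Extensionality)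
open import Relation.Binary.PropositionalEquality using (_≡_; refl)

module _ {A : Set} (I : A → Set) (C : (x : A) → I x → A → Set) where

  TotalRule : (x : A) → I x → Set
  TotalRule x y = Σ A (C x y)

  ConfIC≅ConfBr : NatIso (ConfIC I C) (ConfBr I TotalRule (λ _ _ → proj₁))
  ConfIC≅ConfBr = record
    { to      = λ _ _ g y → assocˡ (g y)
    ; from    = λ _ _ g y → assocʳ (g y)
    ; from∘to = λ _ _ _ → refl
    ; to∘from = λ _ _ _ → refl
    ; natural = λ _ _ _ _ _ → refl
    }

Fibre : {B A : Set} → (B → A) → A → Set
Fibre {B} f z = Σ B (λ b → f b ≡ z)

module _ {B A : Set} (f : B → A) (P : A → Set) where

  Σ-into-fibres : Σ B (λ b → P (f b)) → Σ A (λ z → Fibre f z × P z)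
  Σ-into-fibres (b , p) = f b , (b , refl) , p

  Σ-from-fibres : Σ A (λ z → Fibre f z × P z) → Σ B (λ b → P (f b))
  Σ-from-fibres (_ , (b , refl) , p) = b , p

  Σ-into∘from-fibres : ∀ u → Σ-into-fibres (Σ-from-fibres u) ≡ u
  Σ-into∘from-fibres (_ , (_ , refl) , _) = refl

FibreRule : {A : Set} {I : A → Set} {Br : (x : A) → I x → Set}
  → ((x : A) (y : I x) → Br x y → A) → (x : A) → I x → A → Set
FibreRule ar x y = Fibre (ar x y)

module _ (ext : Extensionality 0ℓ 0ℓ) {A : Set} (I : A → Set)
         (Br : (x : A) → I x → Set) (ar : (x : A) (y : I x) → Br x y → A) where

  ConfBr≅ConfIC : NatIso (ConfBr I Br ar) (ConfIC I (FibreRule ar))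
  ConfBr≅ConfIC = record
    { to      = λ P x g y → Σ-into-fibres (ar x y) P (g y)
    ; from    = λ P x g y → Σ-from-fibres (ar x y) P (g y)
    ; from∘to = λ _ _ _ → refl
    ; to∘from = λ P x g → ext λ y → Σ-into∘from-fibres (ar x y) P (g y)
    ; natural = λ _ _ _ _ _ → refl
    }

lemma4p2 : ((A : Set) (I : A → Set) (C : (x : A) → I x → A → Set)
    → Σ ((x : A) → I x → Set) (λ Br →
    Σ ((x : A) (y : I x) → Br x y → A) (λ ar →
    NatIso (ConfIC I C) (ConfBr I Br ar))))
    × (Extensionality 0ℓ 0ℓ
    → (A : Set) (I : A → Set) (Br : (x : A) → I x → Set)
    (ar : (x : A) (y : I x) → Br x y → A)
    → Σ ((x : A) → I x → A → Set) (λ C →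
    NatIso (ConfBr I Br ar) (ConfIC I C)))
lemma4p2 =
    (λ _ I C → TotalRule I C , (λ _ _ → proj₁) , ConfIC≅ConfBr I C)
  , (λ ext _ I Br ar → FibreRule ar , ConfBr≅ConfIC ext I Br ar)
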